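{- Let $k\ge 1$ and $a_1,\ldots,a_k$ be positive integers, and let $G$ be a simple graph that is degree equivalent to the complete $k$-partite graph $K_{a_1,\ldots,a_k}$. Then $\omega(G)=k$ if and only if $G$ is isomorphic to $K_{a_1,\ldots,a_k}$.
   Context: All graphs are finite simple graphs (no loops, no multiple edges). The degree sequence $D(G)$ of a graph $G$ is the multiset of degrees of its vertices; two graphs are degree equivalent if they have the same degree sequence. $\omega(G)$ is the clique number (size of a largest clique). $K_{a_1,\ldots,a_k}$ denotes the complete $k$-partite graph whose vertex set is partitioned into $k$ independent sets of sizes $a_1,\ldots,a_k$, with any two vertices in different parts adjacent. -}

module Defs where

open import Data.Nat using (ℕ; zero; suc; _≤_; _≟_)
open import Data.Bool using (Bool; true; false; not)
open import Data.Fin using (Fin; splitAt)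
open import Data.Fin.Subset using (Subset; _∈_; ∣_∣)
open import Data.Sum using (inj₁; inj₂)
open import Data.Vec using (Vec; []; _∷_; sum)
open import Data.List using (List; map; allFin)
open import Data.List.Relation.Binary.Permutation.Propositional using (_↭_)
open import Data.Product using (Σ; _×_; _,_)
open import Relation.Nullary using (¬_)
open import Relation.Nullary.Decidable using (⌊_⌋)
open import Relation.Binary.PropositionalEquality using (_≡_; _≢_; refl; sym; cong)
open import Function.Bundles using (_↔_; Inverse)

record Graph (n : ℕ) : Set where
  field
    adj    : Fin n → Fin n → Bool
    adj-sym : ∀ i j → adj i j ≡ adj j i
    adj-irr : ∀ i → adj i i ≡ false
open Graph public

countTrue : List Bool → ℕ
countTrue Data.List.[] = 0
countTrue (true Data.List.∷ bs) = suc (countTrue bs)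
countTrue (false Data.List.∷ bs) = countTrue bs

degree : ∀ {n} → Graph n → Fin n → ℕ
degree G i = countTrue (map (adj G i) (allFin _))

degSeq : ∀ {n} → Graph n → List ℕ
degSeq G = map (degree G) (allFin _)

DegreeEquivalent : ∀ {m n} → Graph m → Graph n → Set
DegreeEquivalent G H = degSeq G ↭ degSeq H

Isomorphic : ∀ {m n} → Graph m → Graph n → Set
Isomorphic {m} {n} G H =
  Σ (Fin m ↔ Fin n) λ f → ∀ i j → adj G i j ≡ adj H (Inverse.to f i) (Inverse.to f j)

IsClique : ∀ {n} → Graph n → Subset n → Set
IsClique G S = ∀ i j → i ∈ S → j ∈ S → i ≢ j → adj G i j ≡ true

CliqueNumber : ∀ {n} → Graph n → ℕ → Set
CliqueNumber {n} G k =
  (Σ (Subset n) λ S → IsClique G S × ∣ S ∣ ≡ k) ×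
  (∀ (S : Subset n) → IsClique G S → ∣ S ∣ ≤ k)

-- complete multipartite graph K_{a_1,...,a_k} on Fin (a_1 + ... + a_k):
-- the first a_1 vertices form part 0, the next a_2 part 1, etc.
part : ∀ {k} (a : Vec ℕ k) → Fin (sum a) → ℕ
part (x ∷ a) i with splitAt x i
... | inj₁ _ = 0
... | inj₂ j = suc (part a j)

private
  ≟-sym : (x y : ℕ) → ⌊ x ≟ y ⌋ ≡ ⌊ y ≟ x ⌋
  ≟-sym x y with x ≟ y | y ≟ x
  ... | Relation.Nullary.yes _ | Relation.Nullary.yes _ = refl
  ... | Relation.Nullary.no _  | Relation.Nullary.no _  = refl
  ... | Relation.Nullary.yes p | Relation.Nullary.no q  = Data.Empty.⊥-elim (q (sym p))
    where import Data.Empty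
  ... | Relation.Nullary.no p  | Relation.Nullary.yes q = Data.Empty.⊥-elim (p (sym q))
    where import Data.Empty

  ≟-refl : (x : ℕ) → ⌊ x ≟ x ⌋ ≡ true
  ≟-refl x with x ≟ x
  ... | Relation.Nullary.yes _ = refl
  ... | Relation.Nullary.no p = Data.Empty.⊥-elim (p refl)
    where import Data.Empty

completeMultipartite : ∀ {k} (a : Vec ℕ k) → Graph (sum a)
completeMultipartite a = record
  { adj = λ i j → not ⌊ part a i ≟ part a j ⌋
  ; adj-sym = λ i j → cong not (≟-sym (part a i) (part a j))
  ; adj-irr = λ i → cong not (≟-refl (part a i))
  }

-- Let E be non-adjacency in G together with the diagonal. The greedy proof of the Caro–Wei bound
-- (repeatedly keep a vertex of least closed E-degree and discard its closed E-neighbourhood) yields an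
-- E-independent set, i.e. a clique of G, with at least ∑ᵤ 1 / (n − deg u) vertices, and strictly more
-- unless E is transitive. Under degree equivalence this sum is the one of K_{a₁,…,aₖ}, namely
-- ∑ₚ aₚ · 1/aₚ = k. Hence ω(G) = k forces E to be an equivalence relation; its class sizes n − deg u are
-- read off the degree sequence, and equivalence relations with the same numbers of vertices in classes
-- of each size are isomorphic. Conversely, an isomorphism onto K gives the vertices of a clique pairwise
-- distinct parts, so cliques have at most k vertices.

module Submission where

open import Defs

open import Data.Bool using (Bool; true; false; not; _∧_; _∨_; if_then_else_)
open import Data.Bool.Properties as Bool
  using (∧-conicalˡ; ∧-conicalʳ; ¬-not; not-¬; not-injective; not-involutive)
open import Data.Empty using (⊥-elim)
open import Data.Fin using (Fin; punchIn; punchOut; _↑ˡ_; _↑ʳ_; splitAt)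
open import Data.Fin.Permutation as Perm using (Permutation; _⟨$⟩ʳ_; insert; insert-punchIn)
open import Data.Fin.Properties
  using (any?; punchInᵢ≢i; punchIn-punchOut; splitAt-↑ˡ; splitAt-↑ʳ) renaming (_≟_ to _≟ᶠ_)
open import Data.Fin.Subset using (Subset; _∈_; ∣_∣)
open import Data.List as List using (allFin)
open import Data.List.Properties using (map-∘; map-tabulate; length-map; length-tabulate)
open import Data.List.Relation.Binary.Permutation.Propositional.Properties using (↭-length; map⁺)
open import Data.Nat using (ℕ; zero; suc; _+_; _*_; _∸_; _≤_; _<_; z≤n; s≤s; _≟_; _<?_; _!; NonZero)
open import Data.Nat.Divisibility using (∣-trans; m∣m*n; m≤n⇒m!∣n!)
open import Data.Nat.DivMod using (_/_; m*[n/m]≡n)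
open import Data.Nat.Induction using (<-wellFounded)
import Data.Nat.ListAction as ListAction
open import Data.Nat.ListAction.Properties using (sum-↭)
open import Data.Nat.Properties
open import Algebra.Properties.Semiring.Sum +-*-semiring
  using (sum; sum-cong-≗; ∑-distrib-+; sum-remove; sum-replicate-zero; *-distribʳ-sum)
open import Data.Product using (Σ; ∃; _×_; _,_; proj₁; proj₂)
open import Data.Sum using (_⊎_; inj₁; inj₂)
open import Data.Vec as Vec using (Vec; []; _∷_; lookup)
open import Data.Vec.Properties using ([]=⇒lookup; lookup⇒[]=; lookup∘tabulate)
open import Function using (_∘_; id)
open import Function.Bundles using (_⇔_; mk⇔; Inverse)
open import Induction.WellFounded using (Acc; acc)
open import Relation.Binary.PropositionalEquality
  using (_≡_; _≢_; refl; sym; trans; cong; cong₂; subst; module ≡-Reasoning)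
open import Relation.Binary.Structures using (IsEquivalence)
open import Relation.Nullary using (Dec; yes; no; does)
open import Relation.Nullary.Decidable
  using (⌊_⌋; ¬?; _×-dec_; decidable-stable; dec-true; dec-false; isYes≗does)

infix 4 _≤[_]_

-- a ≤ b, where a ≡ b is only possible when P holds
_≤[_]_ : ℕ → Set → ℕ → Set
a ≤[ P ] b = a ≤ b × (P ⊎ a < b)

private
  variable
    P Q : Set
    a b c d : ℕ

≤[]-respˡ-≡ : a ≡ b → b ≤[ P ] c → a ≤[ P ] c
≤[]-respˡ-≡ refl b≤c = b≤c

≤[]-respʳ-≡ : b ≡ c → a ≤[ P ] b → a ≤[ P ] c
≤[]-respʳ-≡ refl a≤b = a≤b

≤[]-weaken : (P → Q) → a ≤[ P ] b → a ≤[ Q ] b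
≤[]-weaken P⇒Q (a≤b , inj₁ p)   = a≤b , inj₁ (P⇒Q p)
≤[]-weaken P⇒Q (a≤b , inj₂ a<b) = a≤b , inj₂ a<b

≤[]-trans : a ≤[ P ] b → b ≤[ Q ] c → a ≤[ P × Q ] c
≤[]-trans (a≤b , inj₁ p)   (b≤c , inj₁ q)   = ≤-trans a≤b b≤c , inj₁ (p , q)
≤[]-trans (a≤b , inj₁ _)   (b≤c , inj₂ b<c) = ≤-trans a≤b b≤c , inj₂ (≤-<-trans a≤b b<c)
≤[]-trans (a≤b , inj₂ a<b) (b≤c , _)        = ≤-trans a≤b b≤c , inj₂ (<-≤-trans a<b b≤c)

+-mono-≤[] : a ≤[ P ] b → c ≤[ Q ] d → a + c ≤[ P × Q ] b + d
+-mono-≤[] (a≤b , inj₁ p)   (c≤d , inj₁ q)   = +-mono-≤ a≤b c≤d , inj₁ (p , q)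
+-mono-≤[] (a≤b , inj₁ _)   (c≤d , inj₂ c<d) = +-mono-≤ a≤b c≤d , inj₂ (+-mono-≤-< a≤b c<d)
+-mono-≤[] (a≤b , inj₂ a<b) (c≤d , _)        = +-mono-≤ a≤b c≤d , inj₂ (+-mono-<-≤ a<b c≤d)

∑-mono-≤ : ∀ {n} {f g : Fin n → ℕ} → (∀ i → f i ≤ g i) → sum f ≤ sum g
∑-mono-≤ {zero}  f≤g = z≤n
∑-mono-≤ {suc n} f≤g = +-mono-≤ (f≤g Fin.zero) (∑-mono-≤ (f≤g ∘ Fin.suc))

∑-mono-< : ∀ {n} {f g : Fin n → ℕ} → (∀ i → f i ≤ g i) → ∀ j → f j < g j → sum f < sum g
∑-mono-< f≤g Fin.zero    fj<gj = +-mono-<-≤ fj<gj (∑-mono-≤ (f≤g ∘ Fin.suc))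
∑-mono-< f≤g (Fin.suc j) fj<gj = +-mono-≤-< (f≤g Fin.zero) (∑-mono-< (f≤g ∘ Fin.suc) j fj<gj)

∑-rigid : ∀ {n} {f g : Fin n → ℕ} → (∀ i → f i ≤ g i) → sum f ≤[ (∀ i → f i ≡ g i) ] sum g
∑-rigid {f = f} {g} f≤g with any? (λ i → ¬? (f i ≟ g i))
... | yes (j , fj≢gj) = ∑-mono-≤ f≤g , inj₂ (∑-mono-< f≤g j (≤∧≢⇒< (f≤g j) fj≢gj))
... | no ∄j           = ∑-mono-≤ f≤g , inj₁ λ i → decidable-stable (f i ≟ g i) (λ fi≢gi → ∄j (i , fi≢gi))

∑-const : ∀ n c → sum {n} (λ _ → c) ≡ n * c
∑-const zero    c = refl
∑-const (suc n) c = cong (c +_) (∑-const n c)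

∑-↑ : ∀ x {n} (f : Fin (x + n) → ℕ) → sum f ≡ sum (f ∘ (_↑ˡ n)) + sum (f ∘ (x ↑ʳ_))
∑-↑ zero    f = refl
∑-↑ (suc x) f = trans (cong (f Fin.zero +_) (∑-↑ x (f ∘ Fin.suc))) (sym (+-assoc (f Fin.zero) _ _))

does⇒ : ∀ {A : Set} (A? : Dec A) → does A? ≡ true → A
does⇒ (yes a) _ = a

indicator : Bool → ℕ
indicator b = if b then 1 else 0

FinSet : ℕ → Set
FinSet n = Fin n → Bool

module _ {n : ℕ} where

  infix  4 _⊆_
  infixl 7 _∩_ _∖_

  _⊆_ : FinSet n → FinSet n → Set
  S ⊆ T = ∀ x → S x ≡ true → T x ≡ true

  _∩_ _∖_ : FinSet n → FinSet n → FinSet n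
  (S ∩ T) x = S x ∧ T x
  (S ∖ T) x = S x ∧ not (T x)

  ∅ : FinSet n
  ∅ _ = false

  ∑⟨_⟩ : FinSet n → (Fin n → ℕ) → ℕ
  ∑⟨ S ⟩ f = sum λ x → if S x then f x else 0

  count : FinSet n → ℕ
  count S = ∑⟨ S ⟩ λ _ → 1

module _ {n : ℕ} (S T : FinSet n) {x : Fin n} where

  ∩-intro : S x ≡ true → T x ≡ true → (S ∩ T) x ≡ true
  ∩-intro Sx Tx rewrite Sx | Tx = refl

  ∩-or-∖ : S x ≡ true → (S ∩ T) x ≡ true ⊎ (S ∖ T) x ≡ true
  ∩-or-∖ Sx with T x
  ... | true  rewrite Sx = inj₁ refl
  ... | false rewrite Sx = inj₂ refl

  ∖-∉ : (S ∖ T) x ≡ true → T x ≡ false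
  ∖-∉ p with T x | ∧-conicalʳ (S x) (not (T x)) p
  ... | false | _ = refl

module _ {n : ℕ} (S T : FinSet n) where

  ∩⊆ˡ : S ∩ T ⊆ S
  ∩⊆ˡ x = ∧-conicalˡ (S x) (T x)

  ∩⊆ʳ : S ∩ T ⊆ T
  ∩⊆ʳ x = ∧-conicalʳ (S x) (T x)

  ∖⊆ : S ∖ T ⊆ S
  ∖⊆ x = ∧-conicalˡ (S x) (not (T x))

module _ {a b : ℕ} where

  if-cong : ∀ s → (s ≡ true → a ≡ b) → (if s then a else 0) ≡ (if s then b else 0)
  if-cong true  a≡b = a≡b refl
  if-cong false _   = refl

  if-mono : ∀ s → (s ≡ true → a ≤ b) → (if s then a else 0) ≤ (if s then b else 0)
  if-mono true  a≤b = a≤b refl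
  if-mono false _   = z≤n

module _ {n : ℕ} {S : FinSet n} {f g : Fin n → ℕ} where

  ∑⟨⟩-cong : (∀ x → S x ≡ true → f x ≡ g x) → ∑⟨ S ⟩ f ≡ ∑⟨ S ⟩ g
  ∑⟨⟩-cong f≡g = sum-cong-≗ λ x → if-cong (S x) (f≡g x)

  ∑⟨⟩-rigid : (∀ x → S x ≡ true → f x ≤ g x) → ∑⟨ S ⟩ f ≤[ (∀ x → S x ≡ true → f x ≡ g x) ] ∑⟨ S ⟩ g
  ∑⟨⟩-rigid f≤g = ≤[]-weaken on-S (∑-rigid λ x → if-mono (S x) (f≤g x))
    where
    on-S : (∀ x → (if S x then f x else 0) ≡ (if S x then g x else 0)) → ∀ x → S x ≡ true → f x ≡ g x
    on-S eq x Sx = subst (λ s → (if s then f x else 0) ≡ (if s then g x else 0)) Sx (eq x)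

∑⟨⟩-split : ∀ {n} (S T : FinSet n) f → ∑⟨ S ⟩ f ≡ ∑⟨ S ∩ T ⟩ f + ∑⟨ S ∖ T ⟩ f
∑⟨⟩-split S T f = trans (sum-cong-≗ λ x → pointwise (S x) (T x))
                        (∑-distrib-+ (λ x → if (S ∩ T) x then f x else 0) (λ x → if (S ∖ T) x then f x else 0))
  where
  pointwise : ∀ {a} s t → (if s then a else 0) ≡ (if s ∧ t then a else 0) + (if s ∧ not t then a else 0)
  pointwise {a} true true = sym (+-identityʳ a)
  pointwise true  false = refl
  pointwise false _     = refl

∑⟨⟩-const : ∀ {n} (S : FinSet n) c → ∑⟨ S ⟩ (λ _ → c) ≡ count S * c
∑⟨⟩-const S c = trans (sum-cong-≗ λ x → pointwise (S x)) (sym (*-distribʳ-sum c (indicator ∘ S)))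
  where
  pointwise : ∀ s → (if s then c else 0) ≡ indicator s * c
  pointwise true  = sym (*-identityˡ c)
  pointwise false = refl

indicator-mono : ∀ s t → (s ≡ true → t ≡ true) → indicator s ≤ indicator t
indicator-mono false _ _ = z≤n
indicator-mono true  t s⇒t rewrite s⇒t refl = ≤-refl

module _ {n : ℕ} where

  find-or-empty : (S : FinSet n) → (∃ λ x → S x ≡ true) ⊎ (∀ x → S x ≡ false)
  find-or-empty S with any? (λ x → S x Bool.≟ true)
  ... | yes found = inj₁ found
  ... | no ∄x     = inj₂ λ x → ¬-not λ Sx → ∄x (x , Sx)

  count-cong : {S T : FinSet n} → (∀ x → S x ≡ T x) → count S ≡ count T
  count-cong S≡T = sum-cong-≗ λ x → cong indicator (S≡T x)

  ∑⟨⟩-empty : {S : FinSet n} → (∀ x → S x ≡ false) → ∀ f → ∑⟨ S ⟩ f ≡ 0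
  ∑⟨⟩-empty S≡∅ f =
    trans (sum-cong-≗ λ x → cong (λ s → if s then f x else 0) (S≡∅ x)) (sum-replicate-zero n)

  count-empty : {S : FinSet n} → (∀ x → S x ≡ false) → count S ≡ 0
  count-empty S≡∅ = ∑⟨⟩-empty S≡∅ _

  count-∅ : count (∅ {n}) ≡ 0
  count-∅ = count-empty λ _ → refl

  count-mono : {S T : FinSet n} → S ⊆ T → count S ≤ count T
  count-mono {S} {T} S⊆T = ∑-mono-≤ λ x → indicator-mono (S x) (T x) (S⊆T x)

  count-⊂ : {S T : FinSet n} → S ⊆ T → ∀ x → S x ≡ false → T x ≡ true → count S < count T
  count-⊂ {S} {T} S⊆T x Sx Tx = ∑-mono-< (λ y → indicator-mono (S y) (T y) (S⊆T y)) x 0<1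
    where
    0<1 : indicator (S x) < indicator (T x)
    0<1 rewrite Sx | Tx = s≤s z≤n

  count-pos : (S : FinSet n) → ∀ x → S x ≡ true → 0 < count S
  count-pos S x Sx = subst (_< count S) count-∅
                             (count-⊂ (λ _ ()) x refl Sx)

  ⊆-count-≥⇒⊇ : {S T : FinSet n} → S ⊆ T → count T ≤ count S → T ⊆ S
  ⊆-count-≥⇒⊇ {S} S⊆T T≤S x Tx with S x in Sx
  ... | true  = refl
  ... | false = ⊥-elim (<⇒≱ (count-⊂ S⊆T x Sx Tx) T≤S)

  count-nonempty : (S : FinSet n) → 0 < count S → ∃ λ x → S x ≡ true
  count-nonempty S 0<S with find-or-empty S
  ... | inj₁ found = found
  ... | inj₂ S≡∅   = ⊥-elim (<-irrefl (sym (count-empty S≡∅)) 0<S)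

count-∁ : ∀ {n} (S : FinSet n) → count (not ∘ S) + count S ≡ n
count-∁ {zero}  S = refl
count-∁ {suc n} S with S Fin.zero
... | true  = trans (+-suc _ _) (cong suc (count-∁ (S ∘ Fin.suc)))
... | false = cong suc (count-∁ (S ∘ Fin.suc))

count-≤ : ∀ {n} (S : FinSet n) → count S ≤ n
count-≤ S = m+n≤o⇒n≤o (count (not ∘ S)) (≤-reflexive (count-∁ S))

count-remove : ∀ {n} (S : FinSet (suc n)) p → count S ≡ indicator (S p) + count (S ∘ punchIn p)
count-remove S p = sum-remove {i = p} (indicator ∘ S)

count-insert : ∀ {n} {S T : FinSet n} v → S v ≡ false → T v ≡ true → (∀ x → x ≢ v → S x ≡ T x) →
               count T ≡ suc (count S)
count-insert {suc n} {S} {T} v Sv Tv S≡T = begin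
  count T                                       ≡⟨ count-remove T v ⟩
  indicator (T v) + count (T ∘ punchIn v)       ≡⟨ cong₂ (λ t c → indicator t + c) Tv (sym S≡T-off-v) ⟩
  suc (count (S ∘ punchIn v))                   ≡⟨ cong (λ s → suc (indicator s + count (S ∘ punchIn v))) Sv ⟨
  suc (indicator (S v) + count (S ∘ punchIn v)) ≡⟨ cong suc (count-remove S v) ⟨
  suc (count S)                                 ∎
  where
  open ≡-Reasoning
  S≡T-off-v : count (S ∘ punchIn v) ≡ count (T ∘ punchIn v)
  S≡T-off-v = count-cong λ x → S≡T (punchIn v x) (punchInᵢ≢i v x)

count-≤1 : ∀ {n} {S : FinSet n} → (∀ x y → S x ≡ true → S y ≡ true → x ≡ y) → count S ≤ 1
count-≤1 {zero}      _      = z≤n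
count-≤1 {suc n} {S} unique with find-or-empty S
... | inj₂ S≡∅ = ≤-trans (≤-reflexive (count-empty S≡∅)) z≤n
... | inj₁ (x , Sx) = ≤-reflexive (begin
  count S                                 ≡⟨ count-remove S x ⟩
  indicator (S x) + count (S ∘ punchIn x) ≡⟨ cong₂ (λ s c → indicator s + c) Sx (count-empty only-x) ⟩
  1                                       ∎)
  where
  open ≡-Reasoning
  only-x : ∀ i → S (punchIn x i) ≡ false
  only-x i = ¬-not λ S[x+i] → punchInᵢ≢i x i (sym (unique x (punchIn x i) Sx S[x+i]))

count-≤-injectiveLabel : ∀ {n} k (S : FinSet n) (ℓ : Fin n → ℕ) → (∀ x → S x ≡ true → ℓ x < k) →
                         (∀ x y → S x ≡ true → S y ≡ true → ℓ x ≡ ℓ y → x ≡ y) → count S ≤ k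
count-≤-injectiveLabel zero S ℓ ℓ<0 _ =
  ≤-reflexive (count-empty λ x → ¬-not λ Sx → n≮0 (ℓ<0 x Sx))
count-≤-injectiveLabel (suc k) S ℓ ℓ<1+k injective = begin
  count S                           ≡⟨ ∑⟨⟩-split S top _ ⟩
  count (S ∩ top) + count (S ∖ top) ≤⟨ +-mono-≤ at-most-one-top below-top ⟩
  1 + k                             ∎
  where
  open ≤-Reasoning
  top : FinSet _
  top x = does (ℓ x ≟ k)
  at-most-one-top : count (S ∩ top) ≤ 1
  at-most-one-top = count-≤1 λ x y p q → injective x y (∩⊆ˡ S top x p) (∩⊆ˡ S top y q)
    (trans (does⇒ (ℓ x ≟ k) (∩⊆ʳ S top x p)) (sym (does⇒ (ℓ y ≟ k) (∩⊆ʳ S top y q))))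
  below-top : count (S ∖ top) ≤ k
  below-top = count-≤-injectiveLabel k (S ∖ top) ℓ
    (λ x p → ≤∧≢⇒< (≤-pred (ℓ<1+k x (∖⊆ S top x p)))
                   λ ℓx≡k → not-¬ (dec-true (ℓ x ≟ k) ℓx≡k) (∖-∉ S top p))
    (λ x y p q → injective x y (∖⊆ S top x p) (∖⊆ S top y q))

minimiser : ∀ {n} (S : FinSet n) (h : Fin n → ℕ) {v} → S v ≡ true →
            ∃ λ w → S w ≡ true × (∀ u → S u ≡ true → h w ≤ h u)
minimiser S h {v} Sv = go v (<-wellFounded (h v)) Sv
  where
  go : ∀ v → Acc _<_ (h v) → S v ≡ true → ∃ λ w → S w ≡ true × (∀ u → S u ≡ true → h w ≤ h u)
  go v (acc smaller) Sv with any? (λ u → (S u Bool.≟ true) ×-dec (h u <? h v))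
  ... | yes (u , Su , hu<hv) = go u (smaller hu<hv) Su
  ... | no ∄u                = v , Sv , λ u Su → ≮⇒≥ λ hu<hv → ∄u (u , Su , hu<hv)

-- The Caro–Wei bound and its equality case

-- The Caro–Wei weight 1/c scaled by M! to a natural number (weight M 0 = 0 is junk).
weight : ℕ → ℕ → ℕ
weight M zero        = 0
weight M c@(suc _)   = M ! / c

module _ {M : ℕ} where

  *-weight≡! : ∀ {c} → 1 ≤ c → c ≤ M → c * weight M c ≡ M !
  *-weight≡! {c@(suc c₀)} _ c≤M = m*[n/m]≡n (∣-trans (m∣m*n (c₀ !)) (m≤n⇒m!∣n! c≤M))

  weight-antitone : ∀ {c c′} → 1 ≤ c → c ≤ c′ → c′ ≤ M → weight M c′ ≤ weight M c
  weight-antitone {c@(suc _)} {c′} 1≤c c≤c′ c′≤M = *-cancelˡ-≤ c (begin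
    c * weight M c′  ≤⟨ *-monoˡ-≤ (weight M c′) c≤c′ ⟩
    c′ * weight M c′ ≡⟨ *-weight≡! (≤-trans 1≤c c≤c′) c′≤M ⟩
    M !              ≡⟨ *-weight≡! 1≤c (≤-trans c≤c′ c′≤M) ⟨
    c * weight M c   ∎)
    where open ≤-Reasoning

  weight-injective : ∀ {c c′} → 1 ≤ c → c ≤ M → 1 ≤ c′ → c′ ≤ M → weight M c ≡ weight M c′ → c ≡ c′
  weight-injective {c} {c′} 1≤c c≤M 1≤c′ c′≤M w≡w′ =
    *-cancelʳ-≡ c c′ (weight M c) {{weight≢0}} (begin
      c * weight M c   ≡⟨ *-weight≡! 1≤c c≤M ⟩
      M !              ≡⟨ *-weight≡! 1≤c′ c′≤M ⟨
      c′ * weight M c′ ≡⟨ cong (c′ *_) w≡w′ ⟨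
      c′ * weight M c  ∎)
    where
    open ≡-Reasoning
    weight≢0 : NonZero (weight M c)
    weight≢0 = m*n≢0⇒n≢0 c {{subst NonZero (sym (*-weight≡! 1≤c c≤M)) (M !≢0)}}

BoolRel : ℕ → Set
BoolRel n = Fin n → Fin n → Bool

module _ {n : ℕ} (E : BoolRel n) where

  Independent : FinSet n → Set
  Independent I = ∀ u v → I u ≡ true → I v ≡ true → u ≢ v → E u v ≡ false

  TransitiveOn : FinSet n → Set
  TransitiveOn S = ∀ x y z → S x ≡ true → S y ≡ true → S z ≡ true →
                   E x y ≡ true → E y z ≡ true → E x z ≡ true

module CaroWei {m : ℕ} (E : BoolRel m)
               (E-refl : ∀ u → E u u ≡ true) (E-sym : ∀ u v → E u v ≡ E v u) where

  closedDegree : FinSet m → Fin m → ℕ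
  closedDegree S u = count (S ∩ E u)

  weightOf : FinSet m → ℕ
  weightOf S = ∑⟨ S ⟩ λ u → weight m (closedDegree S u)

  record LargeIndependentSet (S : FinSet m) : Set where
    field
      I           : FinSet m
      I⊆S         : I ⊆ S
      independent : Independent E I
      bound       : weightOf S ≤[ TransitiveOn E S ] m ! * count I

  closedDegree-pos : ∀ {S u} → S u ≡ true → 1 ≤ closedDegree S u
  closedDegree-pos {S} {u} Su = count-pos (S ∩ E u) u (∩-intro S (E u) Su (E-refl u))

  closedDegree-≤ : ∀ S u → closedDegree S u ≤ m
  closedDegree-≤ S u = count-≤ (S ∩ E u)

  transitiveOn-split : ∀ S T → (∀ x y → (S ∩ T) x ≡ true → (S ∩ T) y ≡ true → E x y ≡ true) →
                       (∀ x y → (S ∖ T) x ≡ true → (S ∩ T) y ≡ true → E x y ≡ false) →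
                       TransitiveOn E (S ∖ T) → TransitiveOn E S
  transitiveOn-split S T clique no-cross trans′ x y z Sx Sy Sz Exy Eyz with ∩-or-∖ S T Sy
  ... | inj₁ y∈S∩T = clique x z (joins-∩ Sx y∈S∩T Exy) (joins-∩ Sz y∈S∩T (trans (E-sym z y) Eyz))
    where
    joins-∩ : ∀ {w y} → S w ≡ true → (S ∩ T) y ≡ true → E w y ≡ true → (S ∩ T) w ≡ true
    joins-∩ {w} {y} Sw y∈S∩T Ewy with ∩-or-∖ S T Sw
    ... | inj₁ w∈S∩T = w∈S∩T
    ... | inj₂ w∈S∖T = ⊥-elim (not-¬ Ewy (no-cross w y w∈S∖T y∈S∩T))
  ... | inj₂ y∈S∖T =
    trans′ x y z (joins-∖ Sx y∈S∖T (trans (E-sym y x) Exy)) y∈S∖T (joins-∖ Sz y∈S∖T Eyz) Exy Eyz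
    where
    joins-∖ : ∀ {w y} → S w ≡ true → (S ∖ T) y ≡ true → E y w ≡ true → (S ∖ T) w ≡ true
    joins-∖ {w} {y} Sw y∈S∖T Eyw with ∩-or-∖ S T Sw
    ... | inj₁ w∈S∩T = ⊥-elim (not-¬ Eyw (no-cross y w y∈S∖T w∈S∩T))
    ... | inj₂ w∈S∖T = w∈S∖T

  module Pivot (S : FinSet m) (v : Fin m) (Sv : S v ≡ true)
               (v-min : ∀ u → S u ≡ true → closedDegree S v ≤ closedDegree S u) where

    N S′ : FinSet m
    N  = S ∩ E v
    S′ = S ∖ E v

    N-regular S′-degrees-kept : Set
    N-regular       = ∀ u → N u ≡ true → closedDegree S u ≡ count N
    S′-degrees-kept = ∀ u → S′ u ≡ true → closedDegree S u ≡ closedDegree S′ u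

    weight-split : weightOf S ≡ ∑⟨ N ⟩ (weight m ∘ closedDegree S) + ∑⟨ S′ ⟩ (weight m ∘ closedDegree S)
    weight-split = ∑⟨⟩-split S (E v) (weight m ∘ closedDegree S)

    neighbourhood-weight : ∑⟨ N ⟩ (weight m ∘ closedDegree S) ≤[ N-regular ] m !
    neighbourhood-weight =
      ≤[]-respʳ-≡ N-weight (≤[]-weaken same-degree (∑⟨⟩-rigid antitone))
      where
      1≤d : 1 ≤ count N
      1≤d = closedDegree-pos {S} Sv
      d≤m : count N ≤ m
      d≤m = closedDegree-≤ S v
      N-weight : ∑⟨ N ⟩ (λ _ → weight m (count N)) ≡ m !
      N-weight = trans (∑⟨⟩-const N _) (*-weight≡! 1≤d d≤m)
      antitone : ∀ u → N u ≡ true → weight m (closedDegree S u) ≤ weight m (count N)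
      antitone u Nu = weight-antitone 1≤d (v-min u (∩⊆ˡ S (E v) u Nu)) (closedDegree-≤ S u)
      same-degree : (∀ u → N u ≡ true → weight m (closedDegree S u) ≡ weight m (count N)) → N-regular
      same-degree eq u Nu =
        weight-injective (closedDegree-pos {S} (∩⊆ˡ S (E v) u Nu)) (closedDegree-≤ S u) 1≤d d≤m (eq u Nu)

    rest-weight : ∑⟨ S′ ⟩ (weight m ∘ closedDegree S) ≤[ S′-degrees-kept ] weightOf S′
    rest-weight = ≤[]-weaken same-degree (∑⟨⟩-rigid antitone)
      where
      shrinks : ∀ u → closedDegree S′ u ≤ closedDegree S u
      shrinks u = count-mono λ x p →
        ∩-intro S (E u) (∖⊆ S (E v) x (∩⊆ˡ S′ (E u) x p)) (∩⊆ʳ S′ (E u) x p)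
      antitone : ∀ u → S′ u ≡ true → weight m (closedDegree S u) ≤ weight m (closedDegree S′ u)
      antitone u S′u = weight-antitone (closedDegree-pos {S′} S′u) (shrinks u) (closedDegree-≤ S u)
      same-degree : (∀ u → S′ u ≡ true → weight m (closedDegree S u) ≡ weight m (closedDegree S′ u)) →
                    S′-degrees-kept
      same-degree eq u S′u = weight-injective (closedDegree-pos {S} (∖⊆ S (E v) u S′u)) (closedDegree-≤ S u)
                                              (closedDegree-pos {S′} S′u) (closedDegree-≤ S′ u) (eq u S′u)

    -- closedDegree S u counts the neighbours of u in N plus those in S′, which number closedDegree S′ u.
    no-cross-edge : S′-degrees-kept → ∀ u x → S′ u ≡ true → N x ≡ true → E u x ≡ false
    no-cross-edge same-degree u x S′u Nx = ¬-not λ Eux →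
      <-irrefl (sym in-N≡0) (count-pos (S ∩ E u ∩ E v) x
        (∩-intro (S ∩ E u) (E v) (∩-intro S (E u) (∩⊆ˡ S (E v) x Nx) Eux) (∩⊆ʳ S (E v) x Nx)))
      where
      in-S′ : closedDegree S′ u ≡ count (S ∩ E u ∖ E v)
      in-S′ = count-cong λ y → rot (S y) (E v y) (E u y)
        where
        rot : ∀ s a b → (s ∧ not a) ∧ b ≡ (s ∧ b) ∧ not a
        rot false _ _ = refl
        rot true  a b = Bool.∧-comm (not a) b
      in-N≡0 : count (S ∩ E u ∩ E v) ≡ 0
      in-N≡0 = +-cancelʳ-≡ _ _ 0 (begin
        count (S ∩ E u ∩ E v) + count (S ∩ E u ∖ E v) ≡⟨ ∑⟨⟩-split (S ∩ E u) (E v) _ ⟨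
        closedDegree S u                              ≡⟨ same-degree u S′u ⟩
        closedDegree S′ u                             ≡⟨ in-S′ ⟩
        count (S ∩ E u ∖ E v)                         ∎)
        where open ≡-Reasoning

    neighbourhood-clique : N-regular → (∀ u x → S′ u ≡ true → N x ≡ true → E u x ≡ false) →
                           ∀ u x → N u ≡ true → N x ≡ true → E u x ≡ true
    neighbourhood-clique regular no-cross u x Nu Nx =
      ∩⊆ʳ S (E u) x (⊆-count-≥⇒⊇ stays-in-N (≤-reflexive (sym (regular u Nu))) x Nx)
      where
      stays-in-N : S ∩ E u ⊆ N
      stays-in-N y p with ∩-or-∖ S (E v) (∩⊆ˡ S (E u) y p)
      ... | inj₁ Ny  = Ny
      ... | inj₂ S′y = ⊥-elim (not-¬ (trans (E-sym y u) (∩⊆ʳ S (E u) y p)) (no-cross y u S′y Nu))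

    extend : LargeIndependentSet S′ → LargeIndependentSet S
    extend smaller = record { I = I ; I⊆S = I⊆S ; independent = independent ; bound = bound }
      where
      open LargeIndependentSet smaller
        renaming (I to I′; I⊆S to I′⊆S′; independent to independent′; bound to bound′)

      I : FinSet m
      I x = does (x ≟ᶠ v) ∨ I′ x

      I′v≡false : I′ v ≡ false
      I′v≡false = ¬-not λ I′v → not-¬ (E-refl v) (∖-∉ S (E v) (I′⊆S′ v I′v))

      ∈I : ∀ {x} → I x ≡ true → x ≡ v ⊎ I′ x ≡ true
      ∈I {x} Ix with x ≟ᶠ v
      ... | yes x≡v = inj₁ x≡v
      ... | no  _   = inj₂ Ix

      I⊆S : I ⊆ S
      I⊆S x Ix with ∈I Ix
      ... | inj₁ refl = Sv
      ... | inj₂ I′x  = ∖⊆ S (E v) x (I′⊆S′ x I′x)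

      independent : Independent E I
      independent x y Ix Iy x≢y with ∈I Ix | ∈I Iy
      ... | inj₁ refl | inj₁ refl = ⊥-elim (x≢y refl)
      ... | inj₁ refl | inj₂ I′y  = ∖-∉ S (E v) (I′⊆S′ y I′y)
      ... | inj₂ I′x  | inj₁ refl = trans (E-sym x v) (∖-∉ S (E v) (I′⊆S′ x I′x))
      ... | inj₂ I′x  | inj₂ I′y  = independent′ x y I′x I′y x≢y

      count-I : count I ≡ suc (count I′)
      count-I = count-insert v I′v≡false (cong (_∨ I′ v) (dec-true (v ≟ᶠ v) refl))
                             λ x x≢v → sym (cong (_∨ I′ x) (dec-false (x ≟ᶠ v) x≢v))

      bound : weightOf S ≤[ TransitiveOn E S ] m ! * count I
      bound = ≤[]-respˡ-≡ weight-split
             (≤[]-respʳ-≡ (sym (trans (cong (m ! *_) count-I) (*-suc (m !) (count I′))))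
             (≤[]-weaken transitive (+-mono-≤[] neighbourhood-weight (≤[]-trans rest-weight bound′))))
        where
        transitive : N-regular × S′-degrees-kept × TransitiveOn E S′ → TransitiveOn E S
        transitive (regular , same-degree , trans′) =
          transitiveOn-split S (E v) (neighbourhood-clique regular no-cross) no-cross trans′
          where no-cross = no-cross-edge same-degree

  largeIndependentSet : ∀ S → LargeIndependentSet S
  largeIndependentSet S = go S (<-wellFounded (count S))
    where
    go : ∀ S → Acc _<_ (count S) → LargeIndependentSet S
    go S _ with find-or-empty S
    go S _ | inj₂ S≡∅ = record
      { I = ∅ {m} ; I⊆S = λ _ () ; independent = λ _ _ () ; bound = W≤0 , inj₁ vacuous }
      where
      W≤0 : weightOf S ≤ m ! * count (∅ {m})
      W≤0 = ≤-reflexive (trans (∑⟨⟩-empty S≡∅ _)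
                               (sym (trans (cong (m ! *_) (count-∅ {m})) (*-zeroʳ (m !)))))
      vacuous : TransitiveOn E S
      vacuous x _ _ Sx = ⊥-elim (not-¬ Sx (S≡∅ x))
    go S (acc smaller) | inj₁ (_ , Sv₀) with minimiser S (closedDegree S) Sv₀
    ... | v , Sv , v-min = Pivot.extend S v Sv v-min (go (S ∖ E v) (smaller shrinks))
      where
      shrinks : count (S ∖ E v) < count S
      shrinks = count-⊂ (∖⊆ S (E v)) v
                        (trans (cong (λ s → S v ∧ not s) (E-refl v)) (Bool.∧-zeroʳ (S v))) Sv

-- Equivalence relations with the same class sizes

IsBoolEquivalence : ∀ {n} → BoolRel n → Set
IsBoolEquivalence R = IsEquivalence λ i j → R i j ≡ true

module _ {n : ℕ} where

  classSize : BoolRel n → Fin n → ℕ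
  classSize R x = count (R x)

  histogram : BoolRel n → ℕ → ℕ
  histogram R t = count λ x → does (classSize R x ≟ t)

  SameHistogram : BoolRel n → BoolRel n → Set
  SameHistogram R R′ = ∀ t → histogram R t ≡ histogram R′ t

  ClassOrEmpty : BoolRel n → FinSet n → Set
  ClassOrEmpty R P = ∀ x y → P x ≡ true → P y ≡ R x y

  Preserves : BoolRel n → BoolRel n → Permutation n n → Set
  Preserves R R′ π = ∀ i j → R i j ≡ R′ (π ⟨$⟩ʳ i) (π ⟨$⟩ʳ j)

  module _ {R : BoolRel n} (R-equiv : IsBoolEquivalence R) where
    open IsEquivalence R-equiv renaming (refl to R-refl; sym to R-sym; trans to R-trans)

    R-reflᵇ : ∀ i → R i i ≡ true
    R-reflᵇ i = R-refl

    R-symᵇ : ∀ i j → R i j ≡ R j i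
    R-symᵇ i j with R i j in Rij | R j i in Rji
    ... | true  | true  = refl
    ... | false | false = refl
    ... | true  | false = ⊥-elim (not-¬ (R-sym Rij) Rji)
    ... | false | true  = ⊥-elim (not-¬ (R-sym Rji) Rij)

    class-of : ∀ x → ClassOrEmpty R (R x)
    class-of x y z Rxy with R x z in Rxz | R y z in Ryz
    ... | true  | true  = refl
    ... | false | false = refl
    ... | true  | false = ⊥-elim (not-¬ (R-trans (R-sym Rxy) Rxz) Ryz)
    ... | false | true  = ⊥-elim (not-¬ (R-trans Rxy Ryz) Rxz)

restrict : ∀ {n} → BoolRel (suc n) → Fin (suc n) → BoolRel n
restrict R p a b = R (punchIn p a) (punchIn p b)

restrict-equiv : ∀ {n} {R : BoolRel (suc n)} p → IsBoolEquivalence R → IsBoolEquivalence (restrict R p)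
restrict-equiv p R-equiv = record { refl = refl′ ; sym = sym′ ; trans = trans′ }
  where open IsEquivalence R-equiv renaming (refl to refl′; sym to sym′; trans to trans′)

module VertexRemoval {n} {R : BoolRel (suc n)} (R-equiv : IsBoolEquivalence R)
               {P : FinSet (suc n)} (P-class : ClassOrEmpty R P) {p} (Pp : P p ≡ true) where

  R₀ : BoolRel n
  R₀ = restrict R p

  P₀ : FinSet n
  P₀ = P ∘ punchIn p

  s : ℕ
  s = count P₀

  count-P : count P ≡ suc s
  count-P = trans (count-remove P p) (cong (λ b → indicator b + s) Pp)

  member-size : ∀ x → P x ≡ true → classSize R x ≡ suc s
  member-size x Px = trans (count-cong λ y → sym (P-class x y Px)) count-P

  size-after-removal : ∀ b → classSize R (punchIn p b) ≡ indicator (P₀ b) + classSize R₀ b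
  size-after-removal b = trans (count-remove (R (punchIn p b)) p)
    (cong (λ c → indicator c + classSize R₀ b)
          (trans (R-symᵇ R-equiv (punchIn p b) p) (sym (P-class p (punchIn p b) Pp))))

  rest : ℕ → ℕ
  rest t = ∑⟨ not ∘ P₀ ⟩ λ b → indicator (does (classSize R₀ b ≟ t))

  histogram-before : ∀ t → histogram R t ≡ suc s * indicator (does (suc s ≟ t)) + rest t
  histogram-before t = begin
    histogram R t
      ≡⟨ count-remove (λ x → does (classSize R x ≟ t)) p ⟩
    indicator (does (classSize R p ≟ t)) + histogram′
      ≡⟨ cong₂ _+_ (cong (λ k → indicator (does (k ≟ t))) (member-size p Pp))
                   (∑⟨⟩-split (λ _ → true) P₀ _) ⟩
    δ + (∑⟨ P₀ ⟩ f + ∑⟨ not ∘ P₀ ⟩ f)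
      ≡⟨ cong (δ +_) (cong₂ _+_ (trans (∑⟨⟩-cong on-P₀) (∑⟨⟩-const P₀ δ)) (∑⟨⟩-cong off-P₀)) ⟩
    δ + (s * δ + rest t)
      ≡⟨ +-assoc δ (s * δ) (rest t) ⟨
    suc s * δ + rest t
      ∎
    where
    open ≡-Reasoning
    δ : ℕ
    δ = indicator (does (suc s ≟ t))
    f : Fin n → ℕ
    f b = indicator (does (classSize R (punchIn p b) ≟ t))
    histogram′ : ℕ
    histogram′ = count λ b → does (classSize R (punchIn p b) ≟ t)
    on-P₀ : ∀ b → P₀ b ≡ true → f b ≡ δ
    on-P₀ b P₀b = cong (λ k → indicator (does (k ≟ t))) (member-size (punchIn p b) P₀b)
    off-P₀ : ∀ b → not (P₀ b) ≡ true → f b ≡ indicator (does (classSize R₀ b ≟ t))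
    off-P₀ b ¬P₀b = cong (λ k → indicator (does (k ≟ t)))
      (trans (size-after-removal b) (cong (λ x → indicator x + classSize R₀ b) (Bool.not-injective ¬P₀b)))

  histogram-after : ∀ t → histogram R₀ t ≡ s * indicator (does (s ≟ t)) + rest t
  histogram-after t = trans (∑⟨⟩-split (λ _ → true) P₀ _)
                            (cong (_+ rest t) (trans (∑⟨⟩-cong on-P₀) (∑⟨⟩-const P₀ _)))
    where
    on-P₀ : ∀ b → P₀ b ≡ true → indicator (does (classSize R₀ b ≟ t)) ≡ indicator (does (s ≟ t))
    on-P₀ b P₀b = cong (λ k → indicator (does (k ≟ t)))
      (suc-injective (trans (sym (trans (size-after-removal b) (cong (λ x → indicator x + classSize R₀ b) P₀b)))
                            (member-size (punchIn p b) P₀b)))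

IsoRespecting : ∀ {n} → BoolRel n → BoolRel n → FinSet n → FinSet n → Set
IsoRespecting {n} R R′ P P′ =
  Σ (Permutation n n) λ π → Preserves R R′ π × (∀ i → P i ≡ P′ (π ⟨$⟩ʳ i))

-- Prescribing a matching of the classes P and P′ is what lets extend-iso remove a vertex from each,
-- recurse, and put the two vertices back.
ClassIso : ℕ → Set
ClassIso n = ∀ {R R′ : BoolRel n} {P P′} → IsBoolEquivalence R → IsBoolEquivalence R′ →
             ClassOrEmpty R P → ClassOrEmpty R′ P′ → count P ≡ count P′ → SameHistogram R R′ →
             IsoRespecting R R′ P P′

insert-self : ∀ {m n} i j (π : Permutation m n) → insert i j π ⟨$⟩ʳ i ≡ j
insert-self i j π with i ≟ᶠ i
... | yes _   = refl
... | no  i≢i = ⊥-elim (i≢i refl)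

punchIn-view : ∀ {n} (p i : Fin (suc n)) → i ≡ p ⊎ ∃ λ a → i ≡ punchIn p a
punchIn-view p i with i ≟ᶠ p
... | yes i≡p = inj₁ i≡p
... | no  i≢p = inj₂ (punchOut (i≢p ∘ sym) , sym (punchIn-punchOut (i≢p ∘ sym)))

extend-iso : ∀ {n} → ClassIso n → ∀ {R R′ : BoolRel (suc n)} {P P′} →
             (R-equiv : IsBoolEquivalence R) (R′-equiv : IsBoolEquivalence R′) →
             (P-class : ClassOrEmpty R P) (P′-class : ClassOrEmpty R′ P′) →
             count P ≡ count P′ → SameHistogram R R′ →
             ∀ {p p′} → P p ≡ true → P′ p′ ≡ true → IsoRespecting R R′ P P′
extend-iso {n} iso₀ {R} {R′} {P} {P′} R-equiv R′-equiv P-class P′-class |P|≡|P′| same {p} {p′} Pp P′p′ =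
  π , preserves , P-preserved
  where
  module D  = VertexRemoval R-equiv  P-class  Pp
  module D′ = VertexRemoval R′-equiv P′-class P′p′

  s≡s′ : D.s ≡ D′.s
  s≡s′ = suc-injective (trans (sym D.count-P) (trans |P|≡|P′| D′.count-P))

  same₀ : SameHistogram D.R₀ D′.R₀
  same₀ t = begin
    histogram D.R₀ t         ≡⟨ D.histogram-after t ⟩
    D.s * δ D.s + D.rest t   ≡⟨ cong₂ _+_ (cong (λ k → k * δ k) s≡s′) rest≡rest′ ⟩
    D′.s * δ D′.s + D′.rest t ≡⟨ D′.histogram-after t ⟨
    histogram D′.R₀ t        ∎
    where
    open ≡-Reasoning
    δ : ℕ → ℕ
    δ k = indicator (does (k ≟ t))
    rest≡rest′ : D.rest t ≡ D′.rest t
    rest≡rest′ = +-cancelˡ-≡ (suc D′.s * δ (suc D′.s)) _ _ (begin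
      suc D′.s * δ (suc D′.s) + D.rest t  ≡⟨ cong (λ k → suc k * δ (suc k) + D.rest t) s≡s′ ⟨
      suc D.s * δ (suc D.s) + D.rest t    ≡⟨ D.histogram-before t ⟨
      histogram R t                       ≡⟨ same t ⟩
      histogram R′ t                      ≡⟨ D′.histogram-before t ⟩
      suc D′.s * δ (suc D′.s) + D′.rest t ∎)

  restricted : IsoRespecting D.R₀ D′.R₀ D.P₀ D′.P₀
  restricted = iso₀ (restrict-equiv p R-equiv) (restrict-equiv p′ R′-equiv)
                    (λ a b → P-class (punchIn p a) (punchIn p b))
                    (λ a b → P′-class (punchIn p′ a) (punchIn p′ b))
                    s≡s′ same₀

  π₀ : Permutation n n
  π₀ = proj₁ restricted

  π : Permutation (suc n) (suc n)
  π = insert p p′ π₀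

  π-pivot : π ⟨$⟩ʳ p ≡ p′
  π-pivot = insert-self p p′ π₀

  π-punchIn : ∀ a → π ⟨$⟩ʳ punchIn p a ≡ punchIn p′ (π₀ ⟨$⟩ʳ a)
  π-punchIn = insert-punchIn p p′ π₀

  -- The rows of the pivots are the class indicators P and P′, which π₀ matches up.
  pivot-row : ∀ a → R p (punchIn p a) ≡ R′ p′ (punchIn p′ (π₀ ⟨$⟩ʳ a))
  pivot-row a = trans (sym (P-class p (punchIn p a) Pp))
                      (trans (proj₂ (proj₂ restricted) a) (P′-class p′ (punchIn p′ (π₀ ⟨$⟩ʳ a)) P′p′))

  preserves : Preserves R R′ π
  preserves i j with punchIn-view p i | punchIn-view p j
  ... | inj₁ refl       | inj₁ refl       =
    trans (R-reflᵇ R-equiv p) (sym (trans (cong₂ R′ π-pivot π-pivot) (R-reflᵇ R′-equiv p′)))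
  ... | inj₁ refl       | inj₂ (b , refl) =
    trans (pivot-row b) (sym (cong₂ R′ π-pivot (π-punchIn b)))
  ... | inj₂ (a , refl) | inj₁ refl       =
    trans (R-symᵇ R-equiv _ p)
          (trans (pivot-row a) (trans (R-symᵇ R′-equiv p′ _) (sym (cong₂ R′ (π-punchIn a) π-pivot))))
  ... | inj₂ (a , refl) | inj₂ (b , refl) =
    trans (proj₁ (proj₂ restricted) a b) (sym (cong₂ R′ (π-punchIn a) (π-punchIn b)))

  P-preserved : ∀ i → P i ≡ P′ (π ⟨$⟩ʳ i)
  P-preserved i with punchIn-view p i
  ... | inj₁ refl       = trans Pp (sym (trans (cong P′ π-pivot) P′p′))
  ... | inj₂ (a , refl) = trans (proj₂ (proj₂ restricted) a) (sym (cong P′ (π-punchIn a)))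

classIso : ∀ n → ClassIso n
classIso zero    _ _ _ _ _ _ = Perm.id , (λ ()) , (λ ())
classIso (suc n) {R} {R′} {P} {P′} R-equiv R′-equiv P-class P′-class |P|≡|P′| same with find-or-empty P
... | inj₁ (p , Pp) =
  extend-iso (classIso n) R-equiv R′-equiv P-class P′-class |P|≡|P′| same Pp (proj₂ p′)
  where
  p′ : ∃ λ p′ → P′ p′ ≡ true
  p′ = count-nonempty P′ (≤-trans (count-pos P p Pp) (≤-reflexive |P|≡|P′|))
... | inj₂ P≡∅ = π , preserves , λ i → trans (P≡∅ i) (sym (P′≡∅ (π ⟨$⟩ʳ i)))
  where
  -- With no class prescribed, pair the class of vertex 0 with a class of R′ of the same size.
  t : ℕ
  t = classSize R Fin.zero
  p′ : ∃ λ p′ → does (classSize R′ p′ ≟ t) ≡ true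
  p′ = count-nonempty (λ x → does (classSize R′ x ≟ t))
         (≤-trans (count-pos (λ x → does (classSize R x ≟ t)) Fin.zero (dec-true (t ≟ t) refl))
                  (≤-reflexive (same t)))
  same-size : count (R Fin.zero) ≡ count (R′ (proj₁ p′))
  same-size = sym (does⇒ (classSize R′ (proj₁ p′) ≟ t) (proj₂ p′))
  iso : IsoRespecting R R′ (R Fin.zero) (R′ (proj₁ p′))
  iso = extend-iso (classIso n) R-equiv R′-equiv (class-of R-equiv Fin.zero) (class-of R′-equiv (proj₁ p′))
                   same-size same (R-reflᵇ R-equiv Fin.zero) (R-reflᵇ R′-equiv (proj₁ p′))
  π : Permutation (suc n) (suc n)
  π = proj₁ iso
  preserves : Preserves R R′ π
  preserves = proj₁ (proj₂ iso)
  P′≡∅ : ∀ x → P′ x ≡ false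
  P′≡∅ x = ¬-not λ P′x → <-irrefl refl
    (<-≤-trans (count-pos P′ x P′x) (≤-reflexive (trans (sym |P|≡|P′|) (count-empty P≡∅))))

equivalences-isomorphic : ∀ {n} {R R′ : BoolRel n} → IsBoolEquivalence R → IsBoolEquivalence R′ →
                          SameHistogram R R′ → Σ (Permutation n n) (Preserves R R′)
equivalences-isomorphic {n} R-equiv R′-equiv same =
  let π , preserves , _ = classIso n {P = ∅} {P′ = ∅} R-equiv R′-equiv (λ _ _ ()) (λ _ _ ()) refl same
  in  π , preserves

countTrue-tabulate : ∀ {n} (S : FinSet n) → countTrue (List.tabulate S) ≡ count S
countTrue-tabulate {zero}  S = refl
countTrue-tabulate {suc n} S with S Fin.zero
... | true  = cong suc (countTrue-tabulate (S ∘ Fin.suc))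
... | false = countTrue-tabulate (S ∘ Fin.suc)

listSum-tabulate : ∀ {n} (f : Fin n → ℕ) → ListAction.sum (List.tabulate f) ≡ sum f
listSum-tabulate {zero}  f = refl
listSum-tabulate {suc n} f = cong (f Fin.zero +_) (listSum-tabulate (f ∘ Fin.suc))

module _ {n : ℕ} (G : Graph n) where

  degree-count : ∀ i → degree G i ≡ count (adj G i)
  degree-count i = trans (cong countTrue (map-tabulate id (adj G i))) (countTrue-tabulate (adj G i))

  count-nonadjacent : ∀ i → count (not ∘ adj G i) ≡ n ∸ degree G i
  count-nonadjacent i = begin
    count (not ∘ adj G i)                                     ≡⟨ m+n∸n≡m _ (count (adj G i)) ⟨
    count (not ∘ adj G i) + count (adj G i) ∸ count (adj G i)
      ≡⟨ cong₂ _∸_ (count-∁ (adj G i)) (sym (degree-count i)) ⟩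
    n ∸ degree G i                                            ∎
    where open ≡-Reasoning

  listSum-degSeq : ∀ (g : ℕ → ℕ) → ListAction.sum (List.map g (degSeq G)) ≡ sum (g ∘ degree G)
  listSum-degSeq g = begin
    ListAction.sum (List.map g (List.map (degree G) (allFin n))) ≡⟨ cong ListAction.sum (map-∘ (allFin n)) ⟨
    ListAction.sum (List.map (g ∘ degree G) (allFin n))          ≡⟨ cong ListAction.sum (map-tabulate id (g ∘ degree G)) ⟩
    ListAction.sum (List.tabulate (g ∘ degree G))                ≡⟨ listSum-tabulate (g ∘ degree G) ⟩
    sum (g ∘ degree G)                                           ∎
    where open ≡-Reasoning

module _ {m n : ℕ} (G : Graph m) (H : Graph n) (G≈H : DegreeEquivalent G H) where

  degreeEquivalent-order : m ≡ n
  degreeEquivalent-order = begin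
    m                          ≡⟨ length-tabulate id ⟨
    List.length (allFin m)     ≡⟨ length-map (degree G) (allFin m) ⟨
    List.length (degSeq G)     ≡⟨ ↭-length G≈H ⟩
    List.length (degSeq H)     ≡⟨ length-map (degree H) (allFin n) ⟩
    List.length (allFin n)     ≡⟨ length-tabulate id ⟩
    n                          ∎
    where open ≡-Reasoning

  degreeEquivalent-∑ : ∀ (g : ℕ → ℕ) → sum (g ∘ degree G) ≡ sum (g ∘ degree H)
  degreeEquivalent-∑ g = begin
    sum (g ∘ degree G)                       ≡⟨ listSum-degSeq G g ⟨
    ListAction.sum (List.map g (degSeq G))   ≡⟨ sum-↭ (map⁺ g G≈H) ⟩
    ListAction.sum (List.map g (degSeq H))   ≡⟨ listSum-degSeq H g ⟩
    sum (g ∘ degree H)                       ∎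
    where open ≡-Reasoning

-- Complete multipartite graphs

-- the size of the p-th part, with junk value 0 when p ≥ k
partSize : ∀ {k} → Vec ℕ k → ℕ → ℕ
partSize []      _       = 0
partSize (x ∷ a) zero    = x
partSize (x ∷ a) (suc p) = partSize a p

module _ (x : ℕ) {k} (a : Vec ℕ k) where

  part-↑ˡ : ∀ i → part (x ∷ a) (i ↑ˡ Vec.sum a) ≡ 0
  part-↑ˡ i rewrite splitAt-↑ˡ x i (Vec.sum a) = refl

  part-↑ʳ : ∀ j → part (x ∷ a) (x ↑ʳ j) ≡ suc (part a j)
  part-↑ʳ j rewrite splitAt-↑ʳ x (Vec.sum a) j = refl

part-< : ∀ {k} (a : Vec ℕ k) i → part a i < k
part-< (x ∷ a) i with splitAt x i
... | inj₁ _ = s≤s z≤n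
... | inj₂ j = s≤s (part-< a j)

count-part : ∀ {k} (a : Vec ℕ k) p → count (λ y → does (p ≟ part a y)) ≡ partSize a p
count-part []      p = refl
count-part (x ∷ a) zero = begin
  count (λ y → does (0 ≟ part (x ∷ a) y))                     ≡⟨ ∑-↑ x _ ⟩
  count (λ i → does (0 ≟ part (x ∷ a) (i ↑ˡ Vec.sum a))) +
  count (λ j → does (0 ≟ part (x ∷ a) (x ↑ʳ j)))              ≡⟨ cong₂ _+_ first-part (count-empty other-parts) ⟩
  x + 0                                                       ≡⟨ +-identityʳ x ⟩
  x                                                           ∎
  where
  open ≡-Reasoning
  first-part : count (λ i → does (0 ≟ part (x ∷ a) (i ↑ˡ Vec.sum a))) ≡ x
  first-part = trans (count-cong λ i → cong (λ q → does (0 ≟ q)) (part-↑ˡ x a i))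
                     (trans (∑-const x 1) (*-identityʳ x))
  other-parts : ∀ j → does (0 ≟ part (x ∷ a) (x ↑ʳ j)) ≡ false
  other-parts j = cong (λ q → does (0 ≟ q)) (part-↑ʳ x a j)
count-part (x ∷ a) (suc p) = begin
  count (λ y → does (suc p ≟ part (x ∷ a) y))                 ≡⟨ ∑-↑ x _ ⟩
  count (λ i → does (suc p ≟ part (x ∷ a) (i ↑ˡ Vec.sum a))) +
  count (λ j → does (suc p ≟ part (x ∷ a) (x ↑ʳ j)))          ≡⟨ cong₂ _+_ (count-empty first-part) other-parts ⟩
  partSize a p                                                ∎
  where
  open ≡-Reasoning
  first-part : ∀ i → does (suc p ≟ part (x ∷ a) (i ↑ˡ Vec.sum a)) ≡ false
  first-part i = cong (λ q → does (suc p ≟ q)) (part-↑ˡ x a i)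
  other-parts : count (λ j → does (suc p ≟ part (x ∷ a) (x ↑ʳ j))) ≡ partSize a p
  other-parts = trans (count-cong λ j → cong (λ q → does (suc p ≟ q)) (part-↑ʳ x a j)) (count-part a p)

∑-weight-partSize : ∀ {M k} (a : Vec ℕ k) → (∀ i → 1 ≤ lookup a i) → Vec.sum a ≤ M →
                    sum (λ u → weight M (partSize a (part a u))) ≡ k * M !
∑-weight-partSize []      _       _    = refl
∑-weight-partSize {M} {suc k} (x ∷ a) 1≤a |a|≤M = trans (∑-↑ x _) (cong₂ _+_ first-part other-parts)
  where
  first-part : sum (λ i → weight M (partSize (x ∷ a) (part (x ∷ a) (i ↑ˡ Vec.sum a)))) ≡ M !
  first-part = trans (sum-cong-≗ λ i → cong (weight M ∘ partSize (x ∷ a)) (part-↑ˡ x a i))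
                     (trans (∑-const x (weight M x)) (*-weight≡! (1≤a Fin.zero) (≤-trans (m≤m+n x _) |a|≤M)))
  other-parts : sum (λ j → weight M (partSize (x ∷ a) (part (x ∷ a) (x ↑ʳ j)))) ≡ k * M !
  other-parts = trans (sum-cong-≗ λ j → cong (weight M ∘ partSize (x ∷ a)) (part-↑ʳ x a j))
                      (∑-weight-partSize a (1≤a ∘ Fin.suc) (≤-trans (m≤n+m _ x) |a|≤M))

subset-size : ∀ {n} (S : Subset n) → ∣ S ∣ ≡ count (lookup S)
subset-size []           = refl
subset-size (true  ∷ S) = cong suc (subset-size S)
subset-size (false ∷ S) = subset-size S

tabulate-size : ∀ {n} (I : FinSet n) → ∣ Vec.tabulate I ∣ ≡ count I
tabulate-size I = trans (subset-size (Vec.tabulate I)) (count-cong (lookup∘tabulate I))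

nonAdjacent : ∀ {n} → Graph n → BoolRel n
nonAdjacent G i j = not (adj G i j)

module _ {n : ℕ} (G : Graph n) where

  nonAdjacent-refl : ∀ i → nonAdjacent G i i ≡ true
  nonAdjacent-refl i = cong not (adj-irr G i)

  nonAdjacent-sym : ∀ i j → nonAdjacent G i j ≡ nonAdjacent G j i
  nonAdjacent-sym i j = cong not (adj-sym G i j)

  clique-of-independent : ∀ {I} → Independent (nonAdjacent G) I → IsClique G (Vec.tabulate I)
  clique-of-independent {I} independent i j i∈I j∈I i≢j =
    not-injective (independent i j (member i∈I) (member j∈I) i≢j)
    where
    member : ∀ {x} → x ∈ Vec.tabulate I → I x ≡ true
    member {x} x∈I = trans (sym (lookup∘tabulate I x)) ([]=⇒lookup x∈I)

module _ {k : ℕ} (a : Vec ℕ k) where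

  private
    K : Graph (Vec.sum a)
    K = completeMultipartite a

  nonAdjacent-K : ∀ i j → nonAdjacent K i j ≡ does (part a i ≟ part a j)
  nonAdjacent-K i j = trans (not-involutive _) (isYes≗does (part a i ≟ part a j))

  K-isEquivalence : IsBoolEquivalence (nonAdjacent K)
  K-isEquivalence = record
    { refl  = λ {i} → nonAdjacent-refl K i
    ; sym   = λ {i} {j} p → trans (nonAdjacent-sym K j i) p
    ; trans = λ {i} {j} {l} p q → trans (nonAdjacent-K i l) (dec-true (part a i ≟ part a l)
                (trans (does⇒ (part a i ≟ part a j) (trans (sym (nonAdjacent-K i j)) p))
                       (does⇒ (part a j ≟ part a l) (trans (sym (nonAdjacent-K j l)) q))))
    }

  K-nonadjacent-count : ∀ u → count (nonAdjacent K u) ≡ partSize a (part a u)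
  K-nonadjacent-count u = trans (count-cong (nonAdjacent-K u)) (count-part a (part a u))

module MultipartiteDegrees {k} (a : Vec ℕ k) (1≤a : ∀ i → 1 ≤ lookup a i)
            (G : Graph (Vec.sum a)) (G≈K : DegreeEquivalent G (completeMultipartite a)) where

  private
    n : ℕ
    n = Vec.sum a
    K : Graph n
    K = completeMultipartite a

  open CaroWei (nonAdjacent G) (nonAdjacent-refl G) (nonAdjacent-sym G)

  full : FinSet n
  full _ = true

  open LargeIndependentSet (largeIndependentSet full)

  weight-full : weightOf full ≡ n ! * k
  weight-full = begin
    weightOf full                                ≡⟨ sum-cong-≗ (λ u → cong (weight n) (count-nonadjacent G u)) ⟩
    sum (λ u → weight n (n ∸ degree G u))        ≡⟨ degreeEquivalent-∑ G K G≈K (λ d → weight n (n ∸ d)) ⟩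
    sum (λ u → weight n (n ∸ degree K u))        ≡⟨ sum-cong-≗ (λ u → cong (weight n) (K-size u)) ⟩
    sum (λ u → weight n (partSize a (part a u))) ≡⟨ ∑-weight-partSize a 1≤a ≤-refl ⟩
    k * n !                                      ≡⟨ *-comm k (n !) ⟩
    n ! * k                                      ∎
    where
    open ≡-Reasoning
    K-size : ∀ u → n ∸ degree K u ≡ partSize a (part a u)
    K-size u = trans (sym (count-nonadjacent K u)) (K-nonadjacent-count a u)

  k-bound : n ! * k ≤[ TransitiveOn (nonAdjacent G) full ] n ! * count I
  k-bound = ≤[]-respˡ-≡ (sym weight-full) bound

  clique : IsClique G (Vec.tabulate I)
  clique = clique-of-independent G independent

  cliqueNumber-of-bounded : (∀ S → IsClique G S → ∣ S ∣ ≤ k) → CliqueNumber G k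
  cliqueNumber-of-bounded ω≤k = (Vec.tabulate I , clique , ≤-antisym (ω≤k _ clique) k≤|I|) , ω≤k
    where
    k≤|I| : k ≤ ∣ Vec.tabulate I ∣
    k≤|I| = subst (k ≤_) (sym (tabulate-size I)) (*-cancelˡ-≤ (n !) {{n !≢0}} (proj₁ k-bound))

  nonAdjacent-isEquivalence : CliqueNumber G k → IsBoolEquivalence (nonAdjacent G)
  nonAdjacent-isEquivalence (_ , ω≤k) = record
    { refl  = λ {i} → nonAdjacent-refl G i
    ; sym   = λ {i} {j} p → trans (nonAdjacent-sym G j i) p
    ; trans = λ {i} {j} {l} → transitive i j l refl refl refl
    }
    where
    transitive : TransitiveOn (nonAdjacent G) full
    transitive with proj₂ k-bound
    ... | inj₁ t  = t
    ... | inj₂ lt =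
      ⊥-elim (<⇒≱ (*-cancelˡ-< (n !) k (count I) lt) (subst (_≤ k) (tabulate-size I) (ω≤k _ clique)))

  same-histogram : SameHistogram (nonAdjacent G) (nonAdjacent K)
  same-histogram t = begin
    histogram (nonAdjacent G) t                       ≡⟨ sum-cong-≗ (λ x → cong δ (count-nonadjacent G x)) ⟩
    sum (λ x → δ (n ∸ degree G x))                    ≡⟨ degreeEquivalent-∑ G K G≈K (λ d → δ (n ∸ d)) ⟩
    sum (λ x → δ (n ∸ degree K x))                    ≡⟨ sum-cong-≗ (λ x → cong δ (count-nonadjacent K x)) ⟨
    histogram (nonAdjacent K) t                       ∎
    where
    open ≡-Reasoning
    δ : ℕ → ℕ
    δ c = indicator (does (c ≟ t))

  forward : CliqueNumber G k → Isomorphic G K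
  forward ω≡k =
    let π , preserves = equivalences-isomorphic (nonAdjacent-isEquivalence ω≡k) (K-isEquivalence a) same-histogram
    in  π , λ i j → not-injective (preserves i j)

  backward : Isomorphic G K → CliqueNumber G k
  backward (f , preserves) = cliqueNumber-of-bounded λ S S-clique →
    subst (_≤ k) (sym (subset-size S))
      (count-≤-injectiveLabel k (lookup S) (part a ∘ to) (λ x _ → part-< a (to x)) (injective S S-clique))
    where
    to : Fin n → Fin n
    to = Inverse.to f
    injective : ∀ S → IsClique G S → ∀ x y → lookup S x ≡ true → lookup S y ≡ true →
                part a (to x) ≡ part a (to y) → x ≡ y
    injective S S-clique x y Sx Sy same-part with x ≟ᶠ y
    ... | yes x≡y = x≡y
    ... | no  x≢y = ⊥-elim (not-¬ (S-clique x y (lookup⇒[]= x S Sx) (lookup⇒[]= y S Sy) x≢y)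
                                  (trans (preserves x y) (cong not same-part-in-K)))
      where
      same-part-in-K : ⌊ part a (to x) ≟ part a (to y) ⌋ ≡ true
      same-part-in-K = trans (isYes≗does _) (dec-true (part a (to x) ≟ part a (to y)) same-part)

theorem1 : (k : ℕ) → 1 ≤ k → (a : Vec ℕ k) → (∀ i → 1 ≤ lookup a i) →
           ∀ {m} (G : Graph m) → DegreeEquivalent G (completeMultipartite a) →
           (CliqueNumber G k ⇔ Isomorphic G (completeMultipartite a))
theorem1 k _ a 1≤a G G≈K = go (degreeEquivalent-order G (completeMultipartite a) G≈K) G G≈K
  where
  go : ∀ {m} → m ≡ Vec.sum a → (G : Graph m) → DegreeEquivalent G (completeMultipartite a) →
       CliqueNumber G k ⇔ Isomorphic G (completeMultipartite a)
  go refl G G≈K = mk⇔ (MultipartiteDegrees.forward a 1≤a G G≈K) (MultipartiteDegrees.backward a 1≤a G G≈K)
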